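{- Let $F\colon\mathbf C\to\mathbf D$ be left adjoint to $U\colon\mathbf D\to\mathbf C$, with natural isomorphism $\Phi\colon\mathbf D(FX,Y)\cong\mathbf C(X,UY)$, where $\mathbf C,\mathbf D$ have finite coproducts, and let $\mathbb T$ be a guarded iterative monad on $\mathbf D$. Then the monad induced on the composite functor $UTF$ is guarded iterative, when guardedness is defined by: $f\colon X\to UTFY$ is $\sigma$-guarded (for a summand $\sigma$ of $Y$) iff $\Phi^{ -1}f\colon FX\to TFY$ is $F\sigma$-guarded; and the unique solutions are given by $f\mapsto\Phi((\Phi^{ -1}f)^\dagger)$.
   Context: A summand $\sigma\colon Y'\triangleleft Y$ is a pair $(\sigma_1\colon Y'\to Y,\sigma_2\colon Y''\to Y)$ exhibiting $Y$ as a coproduct; complement $\bar\sigma=(\sigma_2,\sigma_1)$. Since $F$ preserves coproducts, $F\sigma$ is a summand of $FY$ (one may identify $F(Y+Z)=FY+FZ$). For a monad $\mathbb T$ (unit $\eta$, Kleisli lifting $(-)^*$), a guardedness is a relation $f\colon X\to_\sigma TY$ between morphisms $f\colon X\to TY$ and summands $\sigma$ of $Y$ closed under: (trv) $T(\mathrm{inl})\circ f\colon X\to_{\mathrm{inr}}T(Y+Z)$ for any $f\colon X\to TY$; (par) $f\colon X\to_\sigma TZ$, $g\colon Y\to_\sigma TZ$ imply $[f,g]\colon X+Y\to_\sigma TZ$; (cmp) $f\colon X\to_{\mathrm{inr}}T(Y+Z)$, $g\colon Y\to_\sigma TV$, $h\colon Z\to TV$ imply $[g,h]^*\circ f\colon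 X\to_\sigma TV$. It is guarded iterative if every $f\colon X\to_{\mathrm{inr}}T(Y+X)$ has a unique solution $f^\dagger\colon X\to TY$, i.e. $f^\dagger=[\eta,f^\dagger]^*\circ f$. The induced monad on $UTF$ has unit $U\eta_F\circ(\text{unit of }F\dashv U)$ and multiplication $U\mu^{\mathbb T}_F\circ UT(\text{counit})_{TF}$. -}

module Defs where

open import Level using (Level; _⊔_) renaming (suc to lsuc)
open import Data.Product using (Σ; _×_; _,_; proj₁; proj₂)
open import Relation.Binary.PropositionalEquality using (_≡_)

record Category (o ℓ : Level) : Set (lsuc (o ⊔ ℓ)) where
  infixr 9 _∘_
  field
    Obj  : Set o
    Hom  : Obj → Obj → Set ℓ
    id   : ∀ {A} → Hom A A
    _∘_  : ∀ {A B C} → Hom B C → Hom A B → Hom A C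
    identityˡ : ∀ {A B} {f : Hom A B} → id ∘ f ≡ f
    identityʳ : ∀ {A B} {f : Hom A B} → f ∘ id ≡ f
    assoc     : ∀ {A B C D} {f : Hom A B} {g : Hom B C} {h : Hom C D} →
                (h ∘ g) ∘ f ≡ h ∘ (g ∘ f)

module _ {o ℓ} (C : Category o ℓ) where
  open Category C

  IsCoproduct : ∀ {A B W} → Hom A W → Hom B W → Set (o ⊔ ℓ)
  IsCoproduct {A} {B} {W} i₁ i₂ =
    ∀ {Z} (f : Hom A Z) (g : Hom B Z) →
      Σ (Hom W Z) λ h → (h ∘ i₁ ≡ f × h ∘ i₂ ≡ g)
                      × (∀ h′ → h′ ∘ i₁ ≡ f → h′ ∘ i₂ ≡ g → h′ ≡ h)

  copair : ∀ {A B W Z} {i₁ : Hom A W} {i₂ : Hom B W} →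
           IsCoproduct i₁ i₂ → Hom A Z → Hom B Z → Hom W Z
  copair c f g = proj₁ (c f g)

  IsInitial : Obj → Set (o ⊔ ℓ)
  IsInitial I = ∀ Z → Σ (Hom I Z) λ h → ∀ h′ → h′ ≡ h

  record HasFiniteCoproducts : Set (o ⊔ ℓ) where
    field
      ⊥obj    : Obj
      ⊥-init  : IsInitial ⊥obj
      _+_     : Obj → Obj → Obj
      inl     : ∀ {A B} → Hom A (A + B)
      inr     : ∀ {A B} → Hom B (A + B)
      +-coprod : ∀ {A B} → IsCoproduct (inl {A} {B}) (inr {A} {B})

  -- candidate summand data σ = (σ₁ : Y′ → Y , σ₂ : Y″ → Y)
  record Cospan (Y : Obj) : Set (o ⊔ ℓ) where
    constructor cospan
    field
      {L R} : Obj
      σ₁ : Hom L Y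
      σ₂ : Hom R Y

  IsSummand : ∀ {Y} → Cospan Y → Set (o ⊔ ℓ)
  IsSummand (cospan σ₁ σ₂) = IsCoproduct σ₁ σ₂

record Functor {o ℓ o′ ℓ′} (C : Category o ℓ) (D : Category o′ ℓ′)
       : Set (o ⊔ ℓ ⊔ o′ ⊔ ℓ′) where
  private
    module C = Category C
    module D = Category D
  field
    F₀ : C.Obj → D.Obj
    F₁ : ∀ {A B} → C.Hom A B → D.Hom (F₀ A) (F₀ B)
    identity     : ∀ {A} → F₁ (C.id {A}) ≡ D.id
    homomorphism : ∀ {A B E} {f : C.Hom A B} {g : C.Hom B E} →
                   F₁ (g C.∘ f) ≡ F₁ g D.∘ F₁ f

mapCospan : ∀ {o ℓ o′ ℓ′} {C : Category o ℓ} {D : Category o′ ℓ′}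
            (F : Functor C D) {Y : Category.Obj C} →
            Cospan C Y → Cospan D (Functor.F₀ F Y)
mapCospan F (cospan σ₁ σ₂) = cospan (Functor.F₁ F σ₁) (Functor.F₁ F σ₂)

record HomAdjunction {o ℓ o′ ℓ′} {C : Category o ℓ} {D : Category o′ ℓ′}
       (F : Functor C D) (U : Functor D C) : Set (o ⊔ ℓ ⊔ o′ ⊔ ℓ′) where
  private
    module C = Category C
    module D = Category D
    module F = Functor F
    module U = Functor U
  field
    Φ    : ∀ {X Y} → D.Hom (F.F₀ X) Y → C.Hom X (U.F₀ Y)
    Φ⁻¹  : ∀ {X Y} → C.Hom X (U.F₀ Y) → D.Hom (F.F₀ X) Y
    Φ∘Φ⁻¹ : ∀ {X Y} (f : C.Hom X (U.F₀ Y)) → Φ (Φ⁻¹ f) ≡ f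
    Φ⁻¹∘Φ : ∀ {X Y} (g : D.Hom (F.F₀ X) Y) → Φ⁻¹ (Φ g) ≡ g
    natural-D : ∀ {X Y Y′} (g : D.Hom Y Y′) (h : D.Hom (F.F₀ X) Y) →
                Φ (g D.∘ h) ≡ U.F₁ g C.∘ Φ h
    natural-C : ∀ {X X′ Y} (h : D.Hom (F.F₀ X) Y) (k : C.Hom X′ X) →
                Φ (h D.∘ F.F₁ k) ≡ Φ h C.∘ k

  unit : ∀ {X} → C.Hom X (U.F₀ (F.F₀ X))
  unit = Φ D.id

  counit : ∀ {Y} → D.Hom (F.F₀ (U.F₀ Y)) Y
  counit = Φ⁻¹ C.id

record KleisliData {o ℓ} (C : Category o ℓ) : Set (o ⊔ ℓ) where
  open Category C
  field
    T₀   : Obj → Obj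
    η    : ∀ {X} → Hom X (T₀ X)
    lift : ∀ {X Y} → Hom X (T₀ Y) → Hom (T₀ X) (T₀ Y)

  T₁ : ∀ {X Y} → Hom X Y → Hom (T₀ X) (T₀ Y)
  T₁ f = lift (η ∘ f)

  μ : ∀ {X} → Hom (T₀ (T₀ X)) (T₀ X)
  μ = lift id

record IsMonad {o ℓ} {C : Category o ℓ} (K : KleisliData C) : Set (o ⊔ ℓ) where
  open Category C
  open KleisliData K
  field
    lift-η  : ∀ {X Y} (f : Hom X (T₀ Y)) → lift f ∘ η ≡ f
    η-lift  : ∀ {X} → lift (η {X}) ≡ id
    lift-∘  : ∀ {X Y Z} (f : Hom X (T₀ Y)) (g : Hom Y (T₀ Z)) →
              lift (lift g ∘ f) ≡ lift g ∘ lift f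

record Monad {o ℓ} (C : Category o ℓ) : Set (o ⊔ ℓ) where
  field
    kleisli : KleisliData C
    isMonad : IsMonad kleisli
  open KleisliData kleisli public

module _ {o ℓ} (C : Category o ℓ) (K : KleisliData C) where
  open Category C
  open KleisliData K

  GuardRel : ∀ r → Set (o ⊔ ℓ ⊔ Level.suc r)
  GuardRel r = ∀ {X Y} → Hom X (T₀ Y) → Cospan C Y → Set r

  record IsGuardedness {r} (G : GuardRel r) : Set (o ⊔ ℓ ⊔ r) where
    field
      trv : ∀ {X Y Z W} {i₁ : Hom Y W} {i₂ : Hom Z W} →
            IsCoproduct C i₁ i₂ → (f : Hom X (T₀ Y)) →
            G (T₁ i₁ ∘ f) (cospan i₂ i₁)
      par : ∀ {X Y Z W} {j₁ : Hom X W} {j₂ : Hom Y W}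
            (c : IsCoproduct C j₁ j₂) (σ : Cospan C Z) → IsSummand C σ →
            (f : Hom X (T₀ Z)) (g : Hom Y (T₀ Z)) →
            G f σ → G g σ → G (copair C c f g) σ
      cmp : ∀ {X Y Z V W} {i₁ : Hom Y W} {i₂ : Hom Z W}
            (c : IsCoproduct C i₁ i₂) (σ : Cospan C V) → IsSummand C σ →
            (f : Hom X (T₀ W)) (g : Hom Y (T₀ V)) (h : Hom Z (T₀ V)) →
            G f (cospan i₂ i₁) → G g σ →
            G (lift (copair C c g h) ∘ f) σ

  IsUniqueSolution : ∀ {X Y W} {i₁ : Hom Y W} {i₂ : Hom X W} →
                     IsCoproduct C i₁ i₂ → Hom X (T₀ W) → Hom X (T₀ Y) →
                     Set ℓ
  IsUniqueSolution c f s =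
    (s ≡ lift (copair C c η s) ∘ f)
    × (∀ s′ → s′ ≡ lift (copair C c η s′) ∘ f → s′ ≡ s)

  IsGuardedIterative : ∀ {r} → GuardRel r → Set (o ⊔ ℓ ⊔ r)
  IsGuardedIterative G =
    ∀ {X Y W} {i₁ : Hom Y W} {i₂ : Hom X W} (c : IsCoproduct C i₁ i₂)
      (f : Hom X (T₀ W)) → G f (cospan i₂ i₁) →
      Σ (Hom X (T₀ Y)) (IsUniqueSolution c f)

module Induced {o ℓ o′ ℓ′} {C : Category o ℓ} {D : Category o′ ℓ′}
       {F : Functor C D} {U : Functor D C} (A : HomAdjunction F U)
       (M : Monad D) where
  private
    module C = Category C
    module D = Category D
    module F = Functor F
    module U = Functor U
    module M = Monad M
  open HomAdjunction A

  UTF : KleisliData C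
  UTF = record
    { T₀   = λ X → U.F₀ (M.T₀ (F.F₀ X))
    ; η    = U.F₁ M.η C.∘ unit
    ; lift = λ f → U.F₁ M.μ C.∘ (U.F₁ (M.T₁ counit) C.∘ U.F₁ (M.T₁ (F.F₁ f)))
    }

  guard : ∀ {r} → GuardRel D M.kleisli r → GuardRel C UTF r
  guard G f σ = G (Φ⁻¹ f) (mapCospan F σ)

module Submission where

-- Φ⁻¹ is a bijection C(X, UTFY) ≅ D(FX, TFY) that sends the unit and the Kleisli
-- composition of the induced monad to those of T, and F preserves coproducts
-- because it is a left adjoint. Hence the guardedness axioms and the solution
-- equation  s = [η , s]* ∘ f  in C translate exactly into the corresponding
-- statements about Φ⁻¹ f and Φ⁻¹ s in D, where they hold by assumption.

open import Defs
open import Data.Product using (_×_; proj₁; proj₂; _,_)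
open import Relation.Binary.PropositionalEquality
  using (_≡_; sym; trans; cong; subst; module ≡-Reasoning)

module HomAdjunctionProperties {o ℓ o′ ℓ′} {C : Category o ℓ} {D : Category o′ ℓ′}
       {F : Functor C D} {U : Functor D C} (A : HomAdjunction F U) where
  private
    module C = Category C
    module D = Category D
    module F = Functor F
    module U = Functor U
  open HomAdjunction A
  open ≡-Reasoning

  Φ⁻¹-injective : ∀ {X Y} {f g : C.Hom X (U.F₀ Y)} → Φ⁻¹ f ≡ Φ⁻¹ g → f ≡ g
  Φ⁻¹-injective {f = f} {g} e = trans (sym (Φ∘Φ⁻¹ f)) (trans (cong Φ e) (Φ∘Φ⁻¹ g))

  Φ⁻¹-naturalˡ : ∀ {X Y Y′} (g : D.Hom Y Y′) (f : C.Hom X (U.F₀ Y)) →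
                 Φ⁻¹ (U.F₁ g C.∘ f) ≡ g D.∘ Φ⁻¹ f
  Φ⁻¹-naturalˡ g f = begin
    Φ⁻¹ (U.F₁ g C.∘ f)          ≡⟨ cong (λ z → Φ⁻¹ (U.F₁ g C.∘ z)) (sym (Φ∘Φ⁻¹ f)) ⟩
    Φ⁻¹ (U.F₁ g C.∘ Φ (Φ⁻¹ f))  ≡⟨ cong Φ⁻¹ (sym (natural-D g (Φ⁻¹ f))) ⟩
    Φ⁻¹ (Φ (g D.∘ Φ⁻¹ f))       ≡⟨ Φ⁻¹∘Φ _ ⟩
    g D.∘ Φ⁻¹ f                 ∎

  Φ⁻¹-naturalʳ : ∀ {X X′ Y} (f : C.Hom X (U.F₀ Y)) (k : C.Hom X′ X) →
                 Φ⁻¹ (f C.∘ k) ≡ Φ⁻¹ f D.∘ F.F₁ k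
  Φ⁻¹-naturalʳ f k = begin
    Φ⁻¹ (f C.∘ k)               ≡⟨ cong (λ z → Φ⁻¹ (z C.∘ k)) (sym (Φ∘Φ⁻¹ f)) ⟩
    Φ⁻¹ (Φ (Φ⁻¹ f) C.∘ k)       ≡⟨ cong Φ⁻¹ (sym (natural-C (Φ⁻¹ f) k)) ⟩
    Φ⁻¹ (Φ (Φ⁻¹ f D.∘ F.F₁ k))  ≡⟨ Φ⁻¹∘Φ _ ⟩
    Φ⁻¹ f D.∘ F.F₁ k            ∎

  counit-∘-F₁ : ∀ {X Y} (k : C.Hom X (U.F₀ Y)) → counit D.∘ F.F₁ k ≡ Φ⁻¹ k
  counit-∘-F₁ k = trans (sym (Φ⁻¹-naturalʳ C.id k)) (cong Φ⁻¹ C.identityˡ)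

  F-preserves-coproduct : ∀ {X Y W} {i₁ : C.Hom X W} {i₂ : C.Hom Y W} →
                          IsCoproduct C i₁ i₂ → IsCoproduct D (F.F₁ i₁) (F.F₁ i₂)
  F-preserves-coproduct {i₁ = i₁} {i₂} c a b with c (Φ a) (Φ b)
  ... | h , (h∘i₁ , h∘i₂) , unique =
    Φ⁻¹ h , (factor i₁ h∘i₁ , factor i₂ h∘i₂) , λ h′ p q →
      trans (sym (Φ⁻¹∘Φ h′)) (cong Φ⁻¹ (unique (Φ h′) (transpose i₁ p) (transpose i₂ q)))
    where
    factor : ∀ {V} (i : C.Hom V _) {e : D.Hom (F.F₀ V) _} →
             h C.∘ i ≡ Φ e → Φ⁻¹ h D.∘ F.F₁ i ≡ e
    factor i {e} eq = trans (sym (Φ⁻¹-naturalʳ h i)) (trans (cong Φ⁻¹ eq) (Φ⁻¹∘Φ e))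
    transpose : ∀ {V} (i : C.Hom V _) {h′ : D.Hom _ _} {e : D.Hom (F.F₀ V) _} →
                h′ D.∘ F.F₁ i ≡ e → Φ h′ C.∘ i ≡ Φ e
    transpose i {h′} eq = trans (sym (natural-C h′ i)) (cong Φ eq)

  Φ⁻¹-copair : ∀ {X Y W Z} {i₁ : C.Hom X W} {i₂ : C.Hom Y W}
               (c : IsCoproduct C i₁ i₂) (cD : IsCoproduct D (F.F₁ i₁) (F.F₁ i₂))
               (a : C.Hom X (U.F₀ Z)) (b : C.Hom Y (U.F₀ Z)) →
               Φ⁻¹ (copair C c a b) ≡ copair D cD (Φ⁻¹ a) (Φ⁻¹ b)
  Φ⁻¹-copair {i₁ = i₁} {i₂} c cD a b =
    proj₂ (proj₂ (cD (Φ⁻¹ a) (Φ⁻¹ b))) (Φ⁻¹ (copair C c a b))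
      (trans (sym (Φ⁻¹-naturalʳ _ i₁)) (cong Φ⁻¹ (proj₁ (proj₁ (proj₂ (c a b))))))
      (trans (sym (Φ⁻¹-naturalʳ _ i₂)) (cong Φ⁻¹ (proj₂ (proj₁ (proj₂ (c a b))))))

module MonadProperties {o ℓ} {D : Category o ℓ} (M : Monad D) where
  private
    module D = Category D
  open Monad M
  open IsMonad isMonad
  open ≡-Reasoning

  lift-∘-T₁ : ∀ {X Y Z} (g : D.Hom Y (T₀ Z)) (a : D.Hom X Y) →
              lift g D.∘ T₁ a ≡ lift (g D.∘ a)
  lift-∘-T₁ g a = begin
    lift g D.∘ lift (η D.∘ a)      ≡⟨ sym (lift-∘ _ g) ⟩
    lift (lift g D.∘ (η D.∘ a))    ≡⟨ cong lift (sym D.assoc) ⟩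
    lift ((lift g D.∘ η) D.∘ a)    ≡⟨ cong (λ z → lift (z D.∘ a)) (lift-η g) ⟩
    lift (g D.∘ a)                 ∎

  μ-∘-T₁ : ∀ {X Y} (a : D.Hom X (T₀ Y)) → μ D.∘ T₁ a ≡ lift a
  μ-∘-T₁ a = trans (lift-∘-T₁ D.id a) (cong lift D.identityˡ)

module InducedProperties {o ℓ o′ ℓ′} {C : Category o ℓ} {D : Category o′ ℓ′}
       {F : Functor C D} {U : Functor D C} (A : HomAdjunction F U) (M : Monad D) where
  private
    module C = Category C
    module D = Category D
    module F = Functor F
    module U = Functor U
    module M = Monad M
  open HomAdjunction A
  open HomAdjunctionProperties A
  open MonadProperties M
  open Induced A M
  module UTF = KleisliData UTF
  open ≡-Reasoning

  Φ⁻¹-η : ∀ {X} → Φ⁻¹ (UTF.η {X}) ≡ M.η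
  Φ⁻¹-η = trans (Φ⁻¹-naturalˡ M.η unit) (trans (cong (M.η D.∘_) (Φ⁻¹∘Φ D.id)) D.identityʳ)

  Φ⁻¹-lift-∘ : ∀ {X Y V} (k : C.Hom Y (UTF.T₀ V)) (f : C.Hom X (UTF.T₀ Y)) →
               Φ⁻¹ (UTF.lift k C.∘ f) ≡ M.lift (Φ⁻¹ k) D.∘ Φ⁻¹ f
  Φ⁻¹-lift-∘ k f = begin
    Φ⁻¹ ((U.F₁ M.μ C.∘ (U.F₁ (M.T₁ counit) C.∘ U.F₁ (M.T₁ (F.F₁ k)))) C.∘ f)
      ≡⟨ cong Φ⁻¹ (trans C.assoc (cong (U.F₁ M.μ C.∘_) C.assoc)) ⟩
    Φ⁻¹ (U.F₁ M.μ C.∘ (U.F₁ (M.T₁ counit) C.∘ (U.F₁ (M.T₁ (F.F₁ k)) C.∘ f)))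
      ≡⟨ Φ⁻¹-naturalˡ _ _ ⟩
    M.μ D.∘ Φ⁻¹ (U.F₁ (M.T₁ counit) C.∘ (U.F₁ (M.T₁ (F.F₁ k)) C.∘ f))
      ≡⟨ cong (M.μ D.∘_) (Φ⁻¹-naturalˡ _ _) ⟩
    M.μ D.∘ (M.T₁ counit D.∘ Φ⁻¹ (U.F₁ (M.T₁ (F.F₁ k)) C.∘ f))
      ≡⟨ cong (λ z → M.μ D.∘ (M.T₁ counit D.∘ z)) (Φ⁻¹-naturalˡ _ _) ⟩
    M.μ D.∘ (M.T₁ counit D.∘ (M.T₁ (F.F₁ k) D.∘ Φ⁻¹ f))
      ≡⟨ sym D.assoc ⟩
    (M.μ D.∘ M.T₁ counit) D.∘ (M.T₁ (F.F₁ k) D.∘ Φ⁻¹ f)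
      ≡⟨ cong (D._∘ (M.T₁ (F.F₁ k) D.∘ Φ⁻¹ f)) (μ-∘-T₁ counit) ⟩
    M.lift counit D.∘ (M.T₁ (F.F₁ k) D.∘ Φ⁻¹ f)
      ≡⟨ sym D.assoc ⟩
    (M.lift counit D.∘ M.T₁ (F.F₁ k)) D.∘ Φ⁻¹ f
      ≡⟨ cong (D._∘ Φ⁻¹ f) (trans (lift-∘-T₁ counit (F.F₁ k)) (cong M.lift (counit-∘-F₁ k))) ⟩
    M.lift (Φ⁻¹ k) D.∘ Φ⁻¹ f
      ∎

  Φ⁻¹-T₁-∘ : ∀ {X Y Z} (i : C.Hom Y Z) (f : C.Hom X (UTF.T₀ Y)) →
             Φ⁻¹ (UTF.T₁ i C.∘ f) ≡ M.T₁ (F.F₁ i) D.∘ Φ⁻¹ f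
  Φ⁻¹-T₁-∘ i f = trans (Φ⁻¹-lift-∘ _ f) (cong (λ z → M.lift z D.∘ Φ⁻¹ f)
    (trans (Φ⁻¹-naturalʳ UTF.η i) (cong (D._∘ F.F₁ i) Φ⁻¹-η)))

  Φ⁻¹-lift-copair : ∀ {X Y Z V W} {i₁ : C.Hom Y W} {i₂ : C.Hom Z W}
                    (c : IsCoproduct C i₁ i₂) (cD : IsCoproduct D (F.F₁ i₁) (F.F₁ i₂))
                    (g : C.Hom Y (UTF.T₀ V)) (h : C.Hom Z (UTF.T₀ V)) (f : C.Hom X (UTF.T₀ W)) →
                    Φ⁻¹ (UTF.lift (copair C c g h) C.∘ f)
                      ≡ M.lift (copair D cD (Φ⁻¹ g) (Φ⁻¹ h)) D.∘ Φ⁻¹ f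
  Φ⁻¹-lift-copair c cD g h f =
    trans (Φ⁻¹-lift-∘ _ f) (cong (λ z → M.lift z D.∘ Φ⁻¹ f) (Φ⁻¹-copair c cD g h))

  Φ⁻¹-solution-equation : ∀ {X Y W} {i₁ : C.Hom Y W} {i₂ : C.Hom X W}
                          (c : IsCoproduct C i₁ i₂) (cD : IsCoproduct D (F.F₁ i₁) (F.F₁ i₂))
                          (f : C.Hom X (UTF.T₀ W)) (s : C.Hom X (UTF.T₀ Y)) →
                          Φ⁻¹ (UTF.lift (copair C c UTF.η s) C.∘ f)
                            ≡ M.lift (copair D cD M.η (Φ⁻¹ s)) D.∘ Φ⁻¹ f
  Φ⁻¹-solution-equation c cD f s =
    trans (Φ⁻¹-lift-copair c cD UTF.η s f)
          (cong (λ z → M.lift (copair D cD z (Φ⁻¹ s)) D.∘ Φ⁻¹ f) Φ⁻¹-η)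

  Φ-preserves-uniqueSolution :
    ∀ {X Y W} {i₁ : C.Hom Y W} {i₂ : C.Hom X W}
    (c : IsCoproduct C i₁ i₂) (cD : IsCoproduct D (F.F₁ i₁) (F.F₁ i₂))
    (f : C.Hom X (UTF.T₀ W)) {t : D.Hom (F.F₀ X) (M.T₀ (F.F₀ Y))} →
    IsUniqueSolution D M.kleisli cD (Φ⁻¹ f) t → IsUniqueSolution C UTF c f (Φ t)
  Φ-preserves-uniqueSolution c cD f {t} (t-solves , t-unique) = solves , unique
    where
    solves : Φ t ≡ UTF.lift (copair C c UTF.η (Φ t)) C.∘ f
    solves = Φ⁻¹-injective (begin
      Φ⁻¹ (Φ t)                                           ≡⟨ Φ⁻¹∘Φ t ⟩
      t                                                   ≡⟨ t-solves ⟩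
      M.lift (copair D cD M.η t) D.∘ Φ⁻¹ f
        ≡⟨ cong (λ z → M.lift (copair D cD M.η z) D.∘ Φ⁻¹ f) (sym (Φ⁻¹∘Φ t)) ⟩
      M.lift (copair D cD M.η (Φ⁻¹ (Φ t))) D.∘ Φ⁻¹ f
        ≡⟨ sym (Φ⁻¹-solution-equation c cD f (Φ t)) ⟩
      Φ⁻¹ (UTF.lift (copair C c UTF.η (Φ t)) C.∘ f)       ∎)
    unique : ∀ s → s ≡ UTF.lift (copair C c UTF.η s) C.∘ f → s ≡ Φ t
    unique s s-solves = Φ⁻¹-injective (trans
      (t-unique (Φ⁻¹ s) (trans (cong Φ⁻¹ s-solves) (Φ⁻¹-solution-equation c cD f s)))
      (sym (Φ⁻¹∘Φ t)))

  guard-isGuardedness : ∀ {r} (G : GuardRel D M.kleisli r) →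
                        IsGuardedness D M.kleisli G → IsGuardedness C UTF (guard G)
  guard-isGuardedness G isG = record
    { trv = λ {_} {_} {_} {_} {i₁} {i₂} c f →
        subst (λ z → G z (cospan (F.F₁ i₂) (F.F₁ i₁)))
          (sym (Φ⁻¹-T₁-∘ i₁ f))
          (trv (F-preserves-coproduct c) (Φ⁻¹ f))
    ; par = λ { c (cospan σ₁ σ₂) σ f g f-guarded g-guarded →
        subst (λ z → G z (cospan (F.F₁ σ₁) (F.F₁ σ₂)))
          (sym (Φ⁻¹-copair c (F-preserves-coproduct c) f g))
          (par (F-preserves-coproduct c) _ (F-preserves-coproduct σ) _ _ f-guarded g-guarded) }
    ; cmp = λ { c (cospan σ₁ σ₂) σ f g h f-guarded g-guarded →
        subst (λ z → G z (cospan (F.F₁ σ₁) (F.F₁ σ₂)))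
          (sym (Φ⁻¹-lift-copair c (F-preserves-coproduct c) g h f))
          (cmp (F-preserves-coproduct c) _ (F-preserves-coproduct σ) _ _ _ f-guarded g-guarded) }
    }
    where open IsGuardedness isG

  guard-isGuardedIterative : ∀ {r} (G : GuardRel D M.kleisli r) →
                             IsGuardedIterative D M.kleisli G →
                             IsGuardedIterative C UTF (guard G)
  guard-isGuardedIterative G it c f f-guarded =
    _ , Φ-preserves-uniqueSolution c (F-preserves-coproduct c) f
          (proj₂ (it (F-preserves-coproduct c) (Φ⁻¹ f) f-guarded))

theorem6p1 : ∀ {o ℓ o′ ℓ′ r} (C : Category o ℓ) (D : Category o′ ℓ′)
               → HasFiniteCoproducts C → HasFiniteCoproducts D
               → (F : Functor C D) (U : Functor D C) (A : HomAdjunction F U)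
               → (M : Monad D) (G : GuardRel D (Monad.kleisli M) r)
               → IsGuardedness D (Monad.kleisli M) G
               → (it : IsGuardedIterative D (Monad.kleisli M) G)
               → IsGuardedness C (Induced.UTF A M) (Induced.guard A M G)
                 × IsGuardedIterative C (Induced.UTF A M) (Induced.guard A M G)
                 × (∀ {X Y W} {i₁ : Category.Hom C Y W} {i₂ : Category.Hom C X W}
                      (c : IsCoproduct C i₁ i₂)
                      (f : Category.Hom C X (KleisliData.T₀ (Induced.UTF A M) W))
                      (g : Induced.guard A M G f (cospan i₂ i₁))
                      (cD : IsCoproduct D (Functor.F₁ F i₁) (Functor.F₁ F i₂))
                      → IsUniqueSolution C (Induced.UTF A M) c f
                          (HomAdjunction.Φ A
                            (proj₁ (it cD (HomAdjunction.Φ⁻¹ A f) g))))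
theorem6p1 C D _ _ F U A M G isG it =
    guard-isGuardedness G isG
  , guard-isGuardedIterative G it
  , λ c f g cD → Φ-preserves-uniqueSolution c cD f (proj₂ (it cD (HomAdjunction.Φ⁻¹ A f) g))
  where open InducedProperties A M
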